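{- Let $I_1=[P_1^\ell P_1^r, Q_1]$ be a properly pointed synchronized interval (of any size $\geq 0$) and $I_2=[P_2,Q_2]$ a synchronized interval (of any size $\geq 0$). Define the Dyck paths \[ P = u P_1^\ell d P_1^r P_2, \qquad Q = u Q_1 d Q_2. \] Then $[P,Q]$ is a synchronized interval. Moreover, the map $(I_1,I_2) \mapsto [P,Q]$ is a bijection from $\bigcup_{n\ge 0}\mathcal{I}^\bullet_n \times \bigcup_{n \geq 0}\mathcal{I}_n$ onto $\bigcup_{n>0}\mathcal{I}_n$.
   Context: A Dyck path of size $n$ is a word in $u=(1,1)$ and $d=(1,-1)$ with $n$ letters of each kind, whose associated walk from $(0,0)$ never goes below the $x$-axis (the empty word is the Dyck path of size $0$). Tamari order on Dyck paths of size $n$: if $P = A\, d\, U\, C$ where $U = uBd$ is a Dyck path whose proper prefixes do not return to the starting height (i.e. $U$ is the excursion starting at the up step following that $d$), then $P$ is covered by $A\,U\,d\,C$; the Tamari order $\leq$ is the reflexive–transitive closure of this relation. For a Dyck path $P$ of size $n\ge1$ with up steps at positions $i_1<\dots<i_n$, $\mathrm{Type}(P)$ is the word $w_1\cdots w_{n-1}$ in $\{N,E\}$ with $w_k=E$ if the step at position $i_k+1$ is $u$, and $w_k=N$ otherwise. A synchronized interval of size $n$ is a pair $[P,Q]$ of Dyck paths of size $n$ with $P\le Q$ in the Tamari order and $\mathrm{Type}(P)=\mathrm{Type}(Q)$; $\mathcal{I}_n$ denotes their set (with $\mathcal{I}_0$ consisting of the pair of empty paths). A properly pointed Dyck path is a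 Dyck path $P$ together with a factorization $P=P^\ell P^r$ into two Dyck paths such that $P^\ell$ is nonempty unless $P$ is empty. A properly pointed synchronized interval $[P^\ell P^r, Q]$ is a synchronized interval $[P,Q]$ together with a factorization of $P$ making it properly pointed; $\mathcal{I}^\bullet_n$ is the set of those of size $n$. -}

module Defs where

open import Data.Nat using (ℕ; zero; suc; _<_)
open import Data.Bool using (Bool; true; false; T)
open import Data.List using (List; []; _∷_; _++_; [_])
open import Data.Product using (Σ; ∃; ∃-syntax; _×_; _,_)
open import Relation.Binary.PropositionalEquality using (_≡_)
open import Relation.Binary.Construct.Closure.ReflexiveTransitive using (Star)

-- Steps: u = (1,1), d = (1,-1)
data Step : Set where
  u d : Step

Word : Set
Word = List Step

ballot : ℕ → Word → Bool
ballot zero    []      = true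
ballot (suc h) []      = false
ballot h       (u ∷ w) = ballot (suc h) w
ballot zero    (d ∷ w) = false
ballot (suc h) (d ∷ w) = ballot h w

IsDyck : Word → Set
IsDyck w = T (ballot 0 w)

size : Word → ℕ
size []      = 0
size (u ∷ w) = suc (size w)
size (d ∷ w) = size w

data Cover : Word → Word → Set where
  cover : (A B C : Word) → IsDyck B →
          Cover (A ++ d ∷ (u ∷ B ++ [ d ]) ++ C) (A ++ (u ∷ B ++ [ d ]) ++ d ∷ C)

_≤T_ : Word → Word → Set
P ≤T Q = Star Cover P Q

data Letter : Set where
  N E : Letter

afterUps : Word → List Letter
afterUps []          = []
afterUps (d ∷ w)     = afterUps w
afterUps (u ∷ [])    = N ∷ []
afterUps (u ∷ u ∷ w) = E ∷ afterUps (u ∷ w)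
afterUps (u ∷ d ∷ w) = N ∷ afterUps (d ∷ w)

dropLast : {A : Set} → List A → List A
dropLast []           = []
dropLast (x ∷ [])     = []
dropLast (x ∷ y ∷ xs) = x ∷ dropLast (y ∷ xs)

-- Type(P) = w_1 ... w_{n-1} (only the first n-1 up steps are recorded)
Type : Word → List Letter
Type P = dropLast (afterUps P)

record Sync (n : ℕ) (P Q : Word) : Set where
  field
    dyckP : IsDyck P
    dyckQ : IsDyck Q
    sizeP : size P ≡ n
    sizeQ : size Q ≡ n
    le    : P ≤T Q
    type≡ : Type P ≡ Type Q

SyncAny : Word → Word → Set
SyncAny P Q = ∃[ n ] Sync n P Q

SyncPos : Word → Word → Set
SyncPos P Q = ∃[ n ] (0 < n × Sync n P Q)

record PPSync (Pl Pr Q : Word) : Set where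
  field
    dyckl  : IsDyck Pl
    dyckr  : IsDyck Pr
    proper : Pl ≡ [] → Pl ++ Pr ≡ []
    sync   : SyncAny (Pl ++ Pr) Q

buildP : Word → Word → Word → Word
buildP Pl Pr P2 = u ∷ Pl ++ d ∷ Pr ++ P2

buildQ : Word → Word → Word
buildQ Q1 Q2 = u ∷ Q1 ++ d ∷ Q2

-- Three facts about the Tamari order carry the argument:
--   * rotation:   d W C ≤ W d C for every Dyck path W (one cover per prime factor of W);
--   * splitting:  if P ≤ Q′Q″ with Q′, Q″ Dyck, then P = P′P″ with P′ ≤ Q′ and P″ ≤ Q″;
--   * projection: if u X d Y ≤ u X′ d Y′ (first-return decompositions), then XY ≤ X′Y′.
-- Types are compared through the full word afterUps (one letter per up step), which is
-- Type followed by N for nonempty paths and splits along first-return decompositions.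
-- The proposition then follows: the construction is an interval by rotation and
-- congruence; it is injective by uniqueness of first-return decompositions; and a
-- positive interval [P, Q] is reached by decomposing Q = u Q₁ d Q₂, splitting P along
-- u Q₁ d · Q₂, and projecting the first factor onto [P₁ˡ P₁ʳ, Q₁].
module Submission where

open import Defs
open import Data.Nat using (ℕ; zero; suc; _+_; _<_; _≤_; z≤n; s≤s)
open import Data.Nat.Properties
  using (+-identityʳ; +-cancelˡ-≡; m+n≡0⇒n≡0; m≤n+m; ≤-trans; ≤-refl; suc-injective; 1+n≢0)
open import Data.Bool using (T)
open import Data.Unit using (tt)
open import Data.Empty using (⊥; ⊥-elim)
open import Data.Maybe using (Maybe; just; nothing)
open import Data.Maybe.Properties using (just-injective)
open import Data.List using (List; []; _∷_; _++_; [_]; _∷ʳ_; length)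
open import Data.List.Properties using (++-assoc; ++-identityʳ; ∷-injective; ∷-injectiveʳ; length-++)
open import Data.Product using (∃-syntax; _×_; _,_; proj₁; proj₂)
open import Data.Sum using (_⊎_; inj₁; inj₂)
open import Relation.Nullary using (¬_)
open import Relation.Binary.PropositionalEquality
  using (_≡_; _≢_; refl; sym; trans; cong; cong₂; subst; subst₂; module ≡-Reasoning)
open import Relation.Binary.Construct.Closure.ReflexiveTransitive using (ε; _◅_; _◅◅_; gmap)

endHeight : ℕ → Word → Maybe ℕ
endHeight h       []      = just h
endHeight h       (u ∷ w) = endHeight (suc h) w
endHeight zero    (d ∷ w) = nothing
endHeight (suc h) (d ∷ w) = endHeight h w

Ballot : ℕ → Word → Set
Ballot h w = endHeight h w ≡ just 0

Dyck : Word → Set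
Dyck = Ballot 0

ballot⇒Ballot : ∀ h w → T (ballot h w) → Ballot h w
ballot⇒Ballot zero    []      _ = refl
ballot⇒Ballot (suc h) []      ()
ballot⇒Ballot zero    (u ∷ w) t = ballot⇒Ballot 1 w t
ballot⇒Ballot (suc h) (u ∷ w) t = ballot⇒Ballot (suc (suc h)) w t
ballot⇒Ballot zero    (d ∷ w) ()
ballot⇒Ballot (suc h) (d ∷ w) t = ballot⇒Ballot h w t

Ballot⇒ballot : ∀ h w → Ballot h w → T (ballot h w)
Ballot⇒ballot zero    []      _ = tt
Ballot⇒ballot (suc h) []      ()
Ballot⇒ballot zero    (u ∷ w) b = Ballot⇒ballot 1 w b
Ballot⇒ballot (suc h) (u ∷ w) b = Ballot⇒ballot (suc (suc h)) w b
Ballot⇒ballot zero    (d ∷ w) ()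
Ballot⇒ballot (suc h) (d ∷ w) b = Ballot⇒ballot h w b

fromIsDyck : ∀ w → IsDyck w → Dyck w
fromIsDyck = ballot⇒Ballot 0

toIsDyck : ∀ w → Dyck w → IsDyck w
toIsDyck = Ballot⇒ballot 0

endHeight-++ : ∀ h X Y {j} → endHeight h X ≡ just j → endHeight h (X ++ Y) ≡ endHeight j Y
endHeight-++ h       []      Y refl = refl
endHeight-++ h       (u ∷ X) Y e    = endHeight-++ (suc h) X Y e
endHeight-++ zero    (d ∷ X) Y ()
endHeight-++ (suc h) (d ∷ X) Y e    = endHeight-++ h X Y e

endHeight-++⁻ : ∀ h X Y {m} → endHeight h (X ++ Y) ≡ just m →
                ∃[ j ] (endHeight h X ≡ just j × endHeight j Y ≡ just m)
endHeight-++⁻ h       []      Y e = h , refl , e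
endHeight-++⁻ h       (u ∷ X) Y e = endHeight-++⁻ (suc h) X Y e
endHeight-++⁻ zero    (d ∷ X) Y ()
endHeight-++⁻ (suc h) (d ∷ X) Y e = endHeight-++⁻ h X Y e

endHeight-suc : ∀ h X {m} → endHeight h X ≡ just m → endHeight (suc h) X ≡ just (suc m)
endHeight-suc h       []      refl = refl
endHeight-suc h       (u ∷ X) e    = endHeight-suc (suc h) X e
endHeight-suc zero    (d ∷ X) ()
endHeight-suc (suc h) (d ∷ X) e    = endHeight-suc h X e

endHeight-from : ∀ k X {m} → endHeight 0 X ≡ just m → endHeight k X ≡ just (k + m)
endHeight-from zero    X e = e
endHeight-from (suc k) X e = endHeight-suc k X (endHeight-from k X e)

dyck-at : ∀ k X → Dyck X → endHeight k X ≡ just k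
dyck-at k X dX = subst (λ n → endHeight k X ≡ just n) (+-identityʳ k) (endHeight-from k X dX)

ballot-from-ground : ∀ k Z {m} → endHeight 0 Z ≡ just m → Ballot k Z → k + m ≡ 0
ballot-from-ground k Z eZ b = just-injective (trans (sym (endHeight-from k Z eZ)) b)

level-before-d : ∀ A Y → Dyck (A ++ d ∷ Y) → ∃[ a ] (endHeight 0 A ≡ just (suc a) × Ballot a Y)
level-before-d A Y dP with endHeight-++⁻ 0 A (d ∷ Y) dP
... | zero  , _  , ()
... | suc a , eA , eY = a , eA , eY

dyck-++ : ∀ X Y → Dyck X → Dyck Y → Dyck (X ++ Y)
dyck-++ X Y dX dY = trans (endHeight-++ 0 X Y dX) dY

dyck-wrap : ∀ X Y → Dyck X → Dyck Y → Dyck (u ∷ X ++ d ∷ Y)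
dyck-wrap X Y dX dY = trans (endHeight-++ 1 X (d ∷ Y) (dyck-at 1 X dX)) dY

dyck-suffix : ∀ X Y → Dyck X → Dyck (X ++ Y) → Dyck Y
dyck-suffix X Y dX dXY = trans (sym (endHeight-++ 0 X Y dX)) dXY

dyck-prefix : ∀ X Y → Dyck Y → Dyck (X ++ Y) → Dyck X
dyck-prefix X Y dY dXY with j , eX , eY ← endHeight-++⁻ 0 X Y dXY =
  subst (λ n → endHeight 0 X ≡ just n) (just-injective (trans (sym (dyck-at j Y dY)) eY)) eX

¬dyck-d : ∀ Y → ¬ Dyck (d ∷ Y)
¬dyck-d Y ()

dyck-size-zero : ∀ X → Dyck X → size X ≡ 0 → X ≡ []
dyck-size-zero []      _  _  = refl
dyck-size-zero (u ∷ X) _  ()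
dyck-size-zero (d ∷ X) () _

size-++ : ∀ X Y → size (X ++ Y) ≡ size X + size Y
size-++ []      Y = refl
size-++ (u ∷ X) Y = cong suc (size-++ X Y)
size-++ (d ∷ X) Y = size-++ X Y

++-factorisations : ∀ {A : Set} (X Y X′ Y′ : List A) → X ++ Y ≡ X′ ++ Y′ →
  (∃[ Z ] (X′ ≡ X ++ Z × Y ≡ Z ++ Y′)) ⊎ (∃[ z ] ∃[ Z ] (X ≡ X′ ++ z ∷ Z × Y′ ≡ z ∷ Z ++ Y))
++-factorisations []      Y X′        Y′ e = inj₁ (X′ , refl , e)
++-factorisations (x ∷ X) Y []        Y′ e = inj₂ (x , X , refl , sym e)
++-factorisations (x ∷ X) Y (x′ ∷ X′) Y′ e with refl , e′ ← ∷-injective e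
  with ++-factorisations X Y X′ Y′ e′
... | inj₁ (Z , p , q)     = inj₁ (Z , cong (x ∷_) p , q)
... | inj₂ (z , Z , p , q) = inj₂ (z , Z , cong (x ∷_) p , q)

++-assoc₃ : ∀ {A : Set} (X Y Z W : List A) → X ++ Y ++ Z ++ W ≡ (X ++ Y ++ Z) ++ W
++-assoc₃ X Y Z W = sym (trans (++-assoc X (Y ++ Z) W) (cong (X ++_) (++-assoc Y Z W)))

first-descent : ∀ j k W → Ballot (j + suc k) W →
                ∃[ W₁ ] ∃[ W₂ ] (W ≡ W₁ ++ d ∷ W₂ × Ballot j W₁ × Ballot k W₂)
first-descent j       k []      e with () ← m+n≡0⇒n≡0 j (just-injective e)
first-descent j       k (u ∷ W) e with W₁ , W₂ , refl , b₁ , b₂ ← first-descent (suc j) k W e =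
  u ∷ W₁ , W₂ , refl , b₁ , b₂
first-descent zero    k (d ∷ W) e = [] , W , refl , refl , e
first-descent (suc j) k (d ∷ W) e with W₁ , W₂ , refl , b₁ , b₂ ← first-descent j k W e =
  d ∷ W₁ , W₂ , refl , b₁ , b₂

first-return : ∀ X → Dyck X → X ≢ [] → ∃[ X₁ ] ∃[ X₂ ] (X ≡ u ∷ X₁ ++ d ∷ X₂ × Dyck X₁ × Dyck X₂)
first-return []      _  X≢[] = ⊥-elim (X≢[] refl)
first-return (d ∷ X) () _
first-return (u ∷ X) dX _ with X₁ , X₂ , refl , d₁ , d₂ ← first-descent 0 0 X dX = X₁ , X₂ , refl , d₁ , d₂

first-descent-unique : ∀ k X X′ {Y Y′} → Ballot k X → Ballot k X′ →
                       X ++ d ∷ Y ≡ X′ ++ d ∷ Y′ → X ≡ X′ × Y ≡ Y′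
first-descent-unique k       []      []       _  _  e  = refl , ∷-injectiveʳ e
first-descent-unique zero    []      (u ∷ X′) _  _  ()
first-descent-unique zero    []      (d ∷ X′) _  () _
first-descent-unique (suc k) []      _        () _  _
first-descent-unique zero    (u ∷ X) []       _  _  ()
first-descent-unique zero    (d ∷ X) _        () _  _
first-descent-unique (suc k) _       []       _  () _
first-descent-unique k       (u ∷ X) (d ∷ X′) _  _  ()
first-descent-unique k       (d ∷ X) (u ∷ X′) _  _  ()
first-descent-unique k       (u ∷ X) (u ∷ X′) b  b′ e
  with refl , refl ← first-descent-unique (suc k) X X′ b b′ (∷-injectiveʳ e) = refl , refl
first-descent-unique (suc k) (d ∷ X) (d ∷ X′) b  b′ e
  with refl , refl ← first-descent-unique k X X′ b b′ (∷-injectiveʳ e) = refl , refl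

first-return-unique : ∀ X X′ {Y Y′} → Dyck X → Dyck X′ →
                      u ∷ X ++ d ∷ Y ≡ u ∷ X′ ++ d ∷ Y′ → X ≡ X′ × Y ≡ Y′
first-return-unique X X′ dX dX′ e = first-descent-unique 0 X X′ dX dX′ (∷-injectiveʳ e)

dyck-extension-trivial : ∀ X Z → Dyck X → Dyck (X ++ Z) → size (X ++ Z) ≡ size X → Z ≡ []
dyck-extension-trivial X Z dX dXZ es = dyck-size-zero Z (dyck-suffix X Z dX dXZ) size-Z≡0
  where
  size-Z≡0 : size Z ≡ 0
  size-Z≡0 = +-cancelˡ-≡ (size X) (size Z) 0
               (trans (sym (size-++ X Z)) (trans es (sym (+-identityʳ (size X)))))

dyck-prefix-unique : ∀ X X′ {Y Y′} → Dyck X → Dyck X′ → size X ≡ size X′ →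
                     X ++ Y ≡ X′ ++ Y′ → X ≡ X′ × Y ≡ Y′
dyck-prefix-unique X X′ dX dX′ es e with ++-factorisations X _ X′ _ e
... | inj₁ (Z , refl , refl) with refl ← dyck-extension-trivial X Z dX dX′ (sym es) =
  sym (++-identityʳ X) , refl
... | inj₂ (z , Z , refl , refl) with () ← dyck-extension-trivial X′ (z ∷ Z) dX′ dX es

excursion : Word → Word
excursion B = u ∷ B ++ [ d ]

dyck-excursion : ∀ B → Dyck B → Dyck (excursion B)
dyck-excursion B dB = dyck-wrap B [] dB refl

cover-dyck : ∀ {P R} → Cover P R → Dyck P → Dyck R
cover-dyck (cover A B C dB) dP with a , eA , eRest ← level-before-d A _ dP = begin
    endHeight 0 (A ++ U ++ d ∷ C)  ≡⟨ endHeight-++ 0 A _ eA ⟩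
    endHeight (suc a) (U ++ d ∷ C) ≡⟨ endHeight-++ (suc a) U (d ∷ C) (dyck-at (suc a) U dU) ⟩
    endHeight a C                  ≡⟨ sym (endHeight-++ a U C (dyck-at a U dU)) ⟩
    endHeight a (U ++ C)           ≡⟨ eRest ⟩
    just 0                         ∎
  where
  open ≡-Reasoning
  U : Word
  U = excursion B
  dU : Dyck U
  dU = dyck-excursion B (fromIsDyck B dB)

cover-size : ∀ {P R} → Cover P R → size P ≡ size R
cover-size (cover A B C _) = begin
    size (A ++ d ∷ U ++ C)          ≡⟨ size-++ A _ ⟩
    size A + size (U ++ C)          ≡⟨ cong (size A +_) (size-++ U C) ⟩
    size A + (size U + size C)      ≡⟨ cong (size A +_) (sym (size-++ U (d ∷ C))) ⟩
    size A + size (U ++ d ∷ C)      ≡⟨ sym (size-++ A _) ⟩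
    size (A ++ U ++ d ∷ C)          ∎
  where
  open ≡-Reasoning
  U : Word
  U = excursion B

≤T-size : ∀ {P R} → P ≤T R → size P ≡ size R
≤T-size ε        = refl
≤T-size (c ◅ cs) = trans (cover-size c) (≤T-size cs)

cover-prefix : ∀ W {X Y} → Cover X Y → Cover (W ++ X) (W ++ Y)
cover-prefix W (cover A B C dB) = subst₂ Cover (++-assoc W A _) (++-assoc W A _) (cover (W ++ A) B C dB)

cover-suffix : ∀ V {X Y} → Cover X Y → Cover (X ++ V) (Y ++ V)
cover-suffix V (cover A B C dB) =
  subst₂ Cover (++-assoc₃ A (d ∷ excursion B) C V) (++-assoc₃ A (excursion B) (d ∷ C) V) (cover A B (C ++ V) dB)

≤T-prefix : ∀ W {X Y} → X ≤T Y → (W ++ X) ≤T (W ++ Y)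
≤T-prefix W = gmap (W ++_) (cover-prefix W)

≤T-suffix : ∀ V {X Y} → X ≤T Y → (X ++ V) ≤T (Y ++ V)
≤T-suffix V = gmap (_++ V) (cover-suffix V)

≤T-after : ∀ B {X Y} → X ≤T Y → (u ∷ B ++ d ∷ X) ≤T (u ∷ B ++ d ∷ Y)
≤T-after B {X} {Y} s =
  subst₂ _≤T_ (cong (u ∷_) (++-assoc B [ d ] X)) (cong (u ∷_) (++-assoc B [ d ] Y)) (≤T-prefix (excursion B) s)

-- Rotation: a down step moves rightwards past any Dyck path, d W C ≤ W d C.  For
-- W = u X₁ d X₂ one cover moves it past u X₁ d, and X₂ remains; the fuel n bounds size W.
d-past-dyck-fuel : ∀ n W C → size W ≤ n → Dyck W → (d ∷ W ++ C) ≤T (W ++ d ∷ C)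
d-past-dyck-fuel n       []      C _          _  = ε
d-past-dyck-fuel n       (d ∷ W) C _          ()
d-past-dyck-fuel zero    (u ∷ W) C ()         _
d-past-dyck-fuel (suc n) (u ∷ W) C (s≤s sW≤n) dW with first-return (u ∷ W) dW (λ ())
... | X₁ , X₂ , refl , d₁ , d₂ =
  subst₂ _≤T_ (cong (λ w → d ∷ u ∷ w) (regroup C)) (cong (u ∷_) (regroup (d ∷ C)))
    (cover [] X₁ (X₂ ++ C) (toIsDyck X₁ d₁) ◅ ≤T-prefix (excursion X₁) (d-past-dyck-fuel n X₂ C sX₂≤n d₂))
  where
  regroup : ∀ Z → (X₁ ++ [ d ]) ++ X₂ ++ Z ≡ (X₁ ++ d ∷ X₂) ++ Z
  regroup Z = trans (++-assoc X₁ [ d ] (X₂ ++ Z)) (sym (++-assoc X₁ (d ∷ X₂) Z))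
  sX₂≤n : size X₂ ≤ n
  sX₂≤n = ≤-trans (m≤n+m (size X₂) (size X₁)) (subst (_≤ n) (size-++ X₁ (d ∷ X₂)) sW≤n)

d-past-dyck : ∀ W C → Dyck W → (d ∷ W ++ C) ≤T (W ++ d ∷ C)
d-past-dyck W C = d-past-dyck-fuel (size W) W C ≤-refl

Splits : Word → Word → Word → Set
Splits P Q′ Q″ = ∃[ P′ ] ∃[ P″ ] (P ≡ P′ ++ P″ × P′ ≤T Q′ × P″ ≤T Q″ × Dyck P′ × Dyck P″)

-- Splitting for one cover A d U C ⋖ A U d C: the cut R = R′R″ lies inside A or after the
-- moved d.  It cannot lie inside U: A stands at a positive level and a prefix of U never
-- goes below its starting level, so R′ would not return to the ground.
cover-splits : ∀ {P R} → Cover P R → ∀ R′ R″ → R ≡ R′ ++ R″ → Dyck R′ → Dyck R″ → Dyck P → Splits P R′ R″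
cover-splits (cover A B C dB) R′ R″ eR dR′ dR″ dP with ++-factorisations A (excursion B ++ d ∷ C) R′ R″ eR
... | inj₂ (z , Z , refl , refl) =
  R′ , P″ , ++-assoc R′ (z ∷ Z) _ , ε , cover (z ∷ Z) B C dB ◅ ε ,
  dR′ , dyck-suffix R′ P″ dR′ (subst Dyck (++-assoc R′ (z ∷ Z) _) dP)
  where
  P″ : Word
  P″ = z ∷ Z ++ d ∷ excursion B ++ C
... | inj₁ (Z , refl , eZ) with ++-factorisations (excursion B) (d ∷ C) Z R″ eZ
...   | inj₁ ([] , refl , refl)         = ⊥-elim (¬dyck-d C dR″)
...   | inj₁ (u ∷ Z₁ , refl , ())
...   | inj₁ (d ∷ Z₁ , refl , refl)     =
  P′ , R″ , regroup , cover A B Z₁ dB ◅ ε , ε , dyck-prefix P′ R″ dR″ (subst Dyck regroup dP) , dR″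
  where
  P′ : Word
  P′ = A ++ d ∷ excursion B ++ Z₁
  regroup : A ++ d ∷ excursion B ++ Z₁ ++ R″ ≡ P′ ++ R″
  regroup = ++-assoc₃ A (d ∷ excursion B) Z₁ R″
...   | inj₂ (z , W , eU , _)
  with a , eA , _ ← level-before-d A _ dP
     | m , eZ₀ , _ ← endHeight-++⁻ 0 Z (z ∷ W) (subst Dyck eU (dyck-excursion B (fromIsDyck B dB)))
  with () ← ballot-from-ground (suc a) Z eZ₀ (trans (sym (endHeight-++ 0 A Z eA)) dR′)

≤T-splits : ∀ {P Q} → P ≤T Q → ∀ Q′ Q″ → Q ≡ Q′ ++ Q″ → Dyck Q′ → Dyck Q″ → Dyck P → Splits P Q′ Q″
≤T-splits ε        Q′ Q″ refl dQ′ dQ″ _  = Q′ , Q″ , refl , ε , ε , dQ′ , dQ″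
≤T-splits (c ◅ cs) Q′ Q″ eQ   dQ′ dQ″ dP
  with R′ , R″ , eR , s′ , s″ , dR′ , dR″ ← ≤T-splits cs Q′ Q″ eQ dQ′ dQ″ (cover-dyck c dP)
  with P′ , P″ , eP , t′ , t″ , dP′ , dP″ ← cover-splits c R′ R″ eR dR′ dR″ dP =
  P′ , P″ , eP , t′ ◅◅ s′ , t″ ◅◅ s″ , dP′ , dP″

-- Projection for one cover u X d Y ⋖ u X″ d Y″ between first-return decompositions: the
-- cover acts inside Y, or inside X, or moves the matching d past the first excursion of Y
-- (then XY and X″Y″ coincide).  A cover cannot move a d from inside X to outside it.
cover-project : ∀ {P R} → Cover P R → ∀ X Y X″ Y″ → P ≡ u ∷ X ++ d ∷ Y → R ≡ u ∷ X″ ++ d ∷ Y″ →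
                Dyck X → Dyck X″ → (X ++ Y) ≤T (X″ ++ Y″)
cover-project (cover [] B C dB) X Y X″ Y″ () _ _ _
cover-project (cover (_ ∷ A) B C dB) X Y X″ Y″ eP eR dX dX″
  with refl , eP′ ← ∷-injective eP
  with ++-factorisations A (d ∷ excursion B ++ C) X (d ∷ Y) eP′
... | inj₂ (_ , Z , refl , refl)
  with refl , refl ← first-return-unique X″ X dX″ dX (trans (sym eR) (cong (u ∷_) (++-assoc X (d ∷ Z) _))) =
  ≤T-prefix X (cover Z B C dB ◅ ε)
... | inj₁ ([] , refl , refl)
  with refl , refl ← first-return-unique X″ (A ++ excursion B) dX″
                       (dyck-++ A (excursion B) (subst Dyck (++-identityʳ A) dX) (dyck-excursion B (fromIsDyck B dB)))
                       (trans (sym eR) (cong (u ∷_) (sym (++-assoc A (excursion B) (d ∷ C))))) =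
  subst (_≤T ((A ++ U) ++ C)) (trans (++-assoc A U C) (cong (_++ U ++ C) (sym (++-identityʳ A)))) ε
  where
  U : Word
  U = excursion B
... | inj₁ (z ∷ Z′ , refl , eZ′)
  with refl , eUC ← ∷-injective eZ′
  with ++-factorisations (excursion B) C Z′ (d ∷ Y) eUC
...   | inj₁ (W , refl , refl)
  with refl , refl ← first-return-unique X″ (A ++ excursion B ++ d ∷ W) dX″ (cover-dyck (cover A B W dB) dX)
                       (trans (sym eR) (cong (u ∷_) (++-assoc₃ A (excursion B) (d ∷ W) (d ∷ Y)))) =
  ≤T-suffix Y (cover A B W dB ◅ ε)
...   | inj₂ (_ , W , eU , refl)
  with a , _ , bZ′ ← level-before-d A Z′ dX
     | m , eZ′₀ , _ ← level-before-d Z′ W (subst Dyck eU (dyck-excursion B (fromIsDyck B dB)))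
  with () ← m+n≡0⇒n≡0 a (ballot-from-ground a Z′ eZ′₀ bZ′)

cover-nonempty : ∀ {P R} → Cover P R → R ≢ []
cover-nonempty (cover []      _ _ _) ()
cover-nonempty (cover (_ ∷ _) _ _ _) ()

-- Projection: if u X d Y ≤ u X′ d Y′ with X, Y, X′ Dyck, then XY ≤ X′Y′.  Every path
-- between them has a first-return decomposition too, and each cover is projected.
≤T-project : ∀ {P Q} → P ≤T Q → ∀ X Y X′ Y′ → P ≡ u ∷ X ++ d ∷ Y → Q ≡ u ∷ X′ ++ d ∷ Y′ →
             Dyck X → Dyck Y → Dyck X′ → (X ++ Y) ≤T (X′ ++ Y′)
≤T-project ε X Y X′ Y′ refl eQ dX _ dX′ with refl , refl ← first-return-unique X X′ dX dX′ eQ = ε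
≤T-project (c ◅ cs) X Y X′ Y′ eP eQ dX dY dX′
  with X″ , Y″ , eR , dX″ , dY″ ← first-return _ (cover-dyck c (subst Dyck (sym eP) (dyck-wrap X Y dX dY))) (cover-nonempty c) =
  cover-project c X Y X″ Y″ eP eR dX dX″ ◅◅ ≤T-project cs X″ Y″ X′ Y′ eR eQ dX″ dY″ dX′

nextLetter : Word → Letter
nextLetter (u ∷ _) = E
nextLetter _       = N

afterUps-u : ∀ w → afterUps (u ∷ w) ≡ nextLetter w ∷ afterUps w
afterUps-u []      = refl
afterUps-u (u ∷ w) = refl
afterUps-u (d ∷ w) = refl

afterUps-d : ∀ X Y → afterUps (X ++ d ∷ Y) ≡ afterUps X ++ afterUps Y
afterUps-d []          Y = refl
afterUps-d (d ∷ X)     Y = afterUps-d X Y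
afterUps-d (u ∷ [])    Y = refl
afterUps-d (u ∷ u ∷ X) Y = cong (E ∷_) (afterUps-d (u ∷ X) Y)
afterUps-d (u ∷ d ∷ X) Y = cong (N ∷_) (afterUps-d (d ∷ X) Y)

-- So does the end of a walk down to the ground, which never ends with an up step.
afterUps-++ : ∀ k X Y → Ballot k X → afterUps (X ++ Y) ≡ afterUps X ++ afterUps Y
afterUps-++ k       []          Y _  = refl
afterUps-++ zero    (d ∷ X)     Y ()
afterUps-++ (suc k) (d ∷ X)     Y b  = afterUps-++ k X Y b
afterUps-++ k       (u ∷ [])    Y ()
afterUps-++ k       (u ∷ u ∷ X) Y b  = cong (E ∷_) (afterUps-++ (suc k) (u ∷ X) Y b)
afterUps-++ k       (u ∷ d ∷ X) Y b  = cong (N ∷_) (afterUps-++ (suc k) (d ∷ X) Y b)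

length-afterUps : ∀ X → length (afterUps X) ≡ size X
length-afterUps []      = refl
length-afterUps (d ∷ X) = length-afterUps X
length-afterUps (u ∷ X) = trans (cong length (afterUps-u X)) (cong suc (length-afterUps X))

afterUps-ends-N : ∀ X → afterUps X ≡ [] ⊎ ∃[ L ] (afterUps X ≡ L ∷ʳ N)
afterUps-ends-N []       = inj₁ refl
afterUps-ends-N (d ∷ X)  = afterUps-ends-N X
afterUps-ends-N (u ∷ []) = inj₂ ([] , refl)
afterUps-ends-N (u ∷ u ∷ X) with afterUps-ends-N (u ∷ X)
... | inj₁ e       with () ← trans (sym (afterUps-u X)) e
... | inj₂ (L , e) = inj₂ (E ∷ L , cong (E ∷_) e)
afterUps-ends-N (u ∷ d ∷ X) with afterUps-ends-N (d ∷ X)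
... | inj₁ e       = inj₂ ([] , cong (N ∷_) e)
... | inj₂ (L , e) = inj₂ (N ∷ L , cong (N ∷_) e)

dropLast-∷ʳ : ∀ {A : Set} (L : List A) x → dropLast (L ∷ʳ x) ≡ L
dropLast-∷ʳ []          x = refl
dropLast-∷ʳ (y ∷ [])    x = refl
dropLast-∷ʳ (y ∷ z ∷ L) x = cong (y ∷_) (dropLast-∷ʳ (z ∷ L) x)

afterUps-Type : ∀ X → afterUps X ≡ [] ⊎ afterUps X ≡ Type X ∷ʳ N
afterUps-Type X with afterUps-ends-N X
... | inj₁ e       = inj₁ e
... | inj₂ (L , e) = inj₂ (trans e (cong (_∷ʳ N) (sym (trans (cong dropLast e) (dropLast-∷ʳ L N)))))

empty-vs-∷ʳ : ∀ X Y {L} → size X ≡ size Y → afterUps X ≡ [] → afterUps Y ≡ L ∷ʳ N → ⊥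
empty-vs-∷ʳ X Y {L} es eX eY = 1+n≢0 (m+n≡0⇒n≡0 (length L) (sym lengths))
  where
  open ≡-Reasoning
  lengths : 0 ≡ length L + 1
  lengths = begin
    0                      ≡⟨ cong length (sym eX) ⟩
    length (afterUps X)    ≡⟨ length-afterUps X ⟩
    size X                 ≡⟨ es ⟩
    size Y                 ≡⟨ sym (length-afterUps Y) ⟩
    length (afterUps Y)    ≡⟨ cong length eY ⟩
    length (L ∷ʳ N)        ≡⟨ length-++ L ⟩
    length L + 1           ∎

afterUps-determined : ∀ X Y → size X ≡ size Y → Type X ≡ Type Y → afterUps X ≡ afterUps Y
afterUps-determined X Y es eT with afterUps-Type X | afterUps-Type Y
... | inj₁ eX | inj₁ eY = trans eX (sym eY)
... | inj₂ eX | inj₂ eY = trans eX (trans (cong (_∷ʳ N) eT) (sym eY))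
... | inj₁ eX | inj₂ eY = ⊥-elim (empty-vs-∷ʳ X Y es eX eY)
... | inj₂ eX | inj₁ eY = ⊥-elim (empty-vs-∷ʳ Y X (sym es) eY eX)

++-equal-length : ∀ {A : Set} (X Y X′ Y′ : List A) → length X ≡ length X′ → X ++ Y ≡ X′ ++ Y′ → X ≡ X′ × Y ≡ Y′
++-equal-length []      Y []        Y′ _  e = refl , e
++-equal-length []      Y (_ ∷ _)   Y′ () _
++-equal-length (_ ∷ _) Y []        Y′ () _
++-equal-length (x ∷ X) Y (x′ ∷ X′) Y′ l  e with refl , e′ ← ∷-injective e
  with refl , refl ← ++-equal-length X Y X′ Y′ (suc-injective l) e′ = refl , refl

afterUps-buildQ : ∀ Q₁ Q₂ → afterUps (buildQ Q₁ Q₂) ≡ nextLetter (Q₁ ++ d ∷ Q₂) ∷ afterUps Q₁ ++ afterUps Q₂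
afterUps-buildQ Q₁ Q₂ = trans (afterUps-u _) (cong (nextLetter (Q₁ ++ d ∷ Q₂) ∷_) (afterUps-d Q₁ Q₂))

afterUps-buildP : ∀ Pl Pr P₂ → Dyck Pl → Dyck Pr →
  afterUps (buildP Pl Pr P₂) ≡ nextLetter (Pl ++ d ∷ Pr ++ P₂) ∷ afterUps (Pl ++ Pr) ++ afterUps P₂
afterUps-buildP Pl Pr P₂ dPl dPr = begin
    afterUps (u ∷ Pl ++ d ∷ Pr ++ P₂)               ≡⟨ afterUps-u _ ⟩
    ℓ ∷ afterUps (Pl ++ d ∷ Pr ++ P₂)               ≡⟨ cong (ℓ ∷_) (afterUps-d Pl (Pr ++ P₂)) ⟩
    ℓ ∷ afterUps Pl ++ afterUps (Pr ++ P₂)          ≡⟨ cong (λ w → ℓ ∷ afterUps Pl ++ w) (afterUps-++ 0 Pr P₂ dPr) ⟩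
    ℓ ∷ afterUps Pl ++ afterUps Pr ++ afterUps P₂   ≡⟨ cong (ℓ ∷_) (sym (++-assoc (afterUps Pl) _ _)) ⟩
    ℓ ∷ (afterUps Pl ++ afterUps Pr) ++ afterUps P₂ ≡⟨ cong (λ w → ℓ ∷ w ++ afterUps P₂) (sym (afterUps-++ 0 Pl Pr dPl)) ⟩
    ℓ ∷ afterUps (Pl ++ Pr) ++ afterUps P₂          ∎
  where
  open ≡-Reasoning
  ℓ : Letter
  ℓ = nextLetter (Pl ++ d ∷ Pr ++ P₂)

-- In a properly pointed interval [P₁ˡP₁ʳ, Q₁], P₁ˡ is empty exactly when Q₁ is, so the first
-- up steps of the two constructed paths carry the same letter; and conversely.
nextLetter-agrees : ∀ Pl Pr Q₁ A B → Dyck Pl → Dyck Q₁ → (Pl ≡ [] → Pl ++ Pr ≡ []) →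
                    size (Pl ++ Pr) ≡ size Q₁ → nextLetter (Pl ++ d ∷ A) ≡ nextLetter (Q₁ ++ d ∷ B)
nextLetter-agrees []      Pr []      A B _  _  _      _  = refl
nextLetter-agrees []      Pr (u ∷ Q) A B _  _  proper es with refl ← proper refl with () ← es
nextLetter-agrees (u ∷ P) Pr []      A B _  _  _      ()
nextLetter-agrees (u ∷ P) Pr (u ∷ Q) A B _  _  _      _  = refl
nextLetter-agrees (d ∷ P) Pr Q₁      A B () _  _      _
nextLetter-agrees Pl      Pr (d ∷ Q) A B _  () _      _

proper-from-nextLetter : ∀ Pl Pr Q₁ A B → Dyck Pr → Dyck Q₁ → size (Pl ++ Pr) ≡ size Q₁ →
                         nextLetter (Pl ++ d ∷ A) ≡ nextLetter (Q₁ ++ d ∷ B) → Pl ≡ [] → Pl ++ Pr ≡ []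
proper-from-nextLetter [] Pr []      A B dPr _  es _  refl = dyck-size-zero Pr dPr es
proper-from-nextLetter [] Pr (u ∷ Q) A B _   _  _  () refl
proper-from-nextLetter [] Pr (d ∷ Q) A B _   () _  _  refl

afterUps-build : ∀ Pl Pr Q₁ P₂ Q₂ → Dyck Pl → Dyck Pr → Dyck Q₁ → (Pl ≡ [] → Pl ++ Pr ≡ []) →
  size (Pl ++ Pr) ≡ size Q₁ → afterUps (Pl ++ Pr) ≡ afterUps Q₁ → afterUps P₂ ≡ afterUps Q₂ →
  afterUps (buildP Pl Pr P₂) ≡ afterUps (buildQ Q₁ Q₂)
afterUps-build Pl Pr Q₁ P₂ Q₂ dPl dPr dQ₁ proper es a₁ a₂ = begin
    afterUps (buildP Pl Pr P₂)                                          ≡⟨ afterUps-buildP Pl Pr P₂ dPl dPr ⟩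
    nextLetter (Pl ++ d ∷ Pr ++ P₂) ∷ afterUps (Pl ++ Pr) ++ afterUps P₂ ≡⟨ cong₂ _∷_ first (cong₂ _++_ a₁ a₂) ⟩
    nextLetter (Q₁ ++ d ∷ Q₂) ∷ afterUps Q₁ ++ afterUps Q₂              ≡⟨ sym (afterUps-buildQ Q₁ Q₂) ⟩
    afterUps (buildQ Q₁ Q₂)                                             ∎
  where
  open ≡-Reasoning
  first : nextLetter (Pl ++ d ∷ Pr ++ P₂) ≡ nextLetter (Q₁ ++ d ∷ Q₂)
  first = nextLetter-agrees Pl Pr Q₁ (Pr ++ P₂) Q₂ dPl dQ₁ proper es

afterUps-build⁻¹ : ∀ Pl Pr Q₁ P₂ Q₂ → Dyck Pl → Dyck Pr → size (Pl ++ Pr) ≡ size Q₁ →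
  afterUps (buildP Pl Pr P₂) ≡ afterUps (buildQ Q₁ Q₂) →
  nextLetter (Pl ++ d ∷ Pr ++ P₂) ≡ nextLetter (Q₁ ++ d ∷ Q₂) × afterUps (Pl ++ Pr) ≡ afterUps Q₁ × afterUps P₂ ≡ afterUps Q₂
afterUps-build⁻¹ Pl Pr Q₁ P₂ Q₂ dPl dPr es e
  with first , rest ← ∷-injective (trans (sym (afterUps-buildP Pl Pr P₂ dPl dPr)) (trans e (afterUps-buildQ Q₁ Q₂))) =
  first , ++-equal-length (afterUps (Pl ++ Pr)) _ (afterUps Q₁) _ lengths rest
  where
  lengths : length (afterUps (Pl ++ Pr)) ≡ length (afterUps Q₁)
  lengths = trans (length-afterUps (Pl ++ Pr)) (trans es (sym (length-afterUps Q₁)))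

sync-dyckP : ∀ {n P Q} → Sync n P Q → Dyck P
sync-dyckP {P = P} I = fromIsDyck P (Sync.dyckP I)

sync-dyckQ : ∀ {n P Q} → Sync n P Q → Dyck Q
sync-dyckQ {Q = Q} I = fromIsDyck Q (Sync.dyckQ I)

sync-size : ∀ {n P Q} → Sync n P Q → size P ≡ size Q
sync-size I = trans (Sync.sizeP I) (sym (Sync.sizeQ I))

sync-afterUps : ∀ {n P Q} → Sync n P Q → afterUps P ≡ afterUps Q
sync-afterUps {P = P} {Q} I = afterUps-determined P Q (sync-size I) (Sync.type≡ I)

pointed-interval : ∀ {Pl Pr Q} (I : PPSync Pl Pr Q) → Sync (proj₁ (PPSync.sync I)) (Pl ++ Pr) Q
pointed-interval I = proj₂ (PPSync.sync I)

pointed-dyckQ : ∀ {Pl Pr Q} → PPSync Pl Pr Q → Dyck Q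
pointed-dyckQ I = sync-dyckQ (pointed-interval I)

pointed-dyckˡ : ∀ {Pl Pr Q} → PPSync Pl Pr Q → Dyck Pl
pointed-dyckˡ {Pl} I = fromIsDyck Pl (PPSync.dyckl I)

pointed-dyckʳ : ∀ {Pl Pr Q} → PPSync Pl Pr Q → Dyck Pr
pointed-dyckʳ {Pr = Pr} I = fromIsDyck Pr (PPSync.dyckr I)

pointed-size : ∀ {Pl Pr Pr′ Q} → PPSync Pl Pr Q → PPSync Pl Pr′ Q → size Pr ≡ size Pr′
pointed-size {Pl} {Pr} {Pr′} I I′ = +-cancelˡ-≡ (size Pl) (size Pr) (size Pr′)
  (trans (sym (size-++ Pl Pr)) (trans (sync-size (pointed-interval I))
    (trans (sym (sync-size (pointed-interval I′))) (size-++ Pl Pr′))))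

synchronized : ∀ P Q → Dyck P → Dyck Q → P ≤T Q → afterUps P ≡ afterUps Q → Sync (size Q) P Q
synchronized P Q dP dQ le eA = record
  { dyckP = toIsDyck P dP ; dyckQ = toIsDyck Q dQ ; sizeP = ≤T-size le ; sizeQ = refl
  ; le = le ; type≡ = cong dropLast eA }

positive-size-nonempty : ∀ Q {n} → size Q ≡ n → 0 < n → Q ≢ []
positive-size-nonempty _ refl () refl

-- The construction is monotone:  u P₁ˡ d P₁ʳ P₂ ≤ u P₁ˡ P₁ʳ d P₂ ≤ u Q₁ d P₂ ≤ u Q₁ d Q₂,
-- by rotation, then the two comparisons in their contexts.
buildP≤buildQ : ∀ Pl Pr Q₁ P₂ Q₂ → Dyck Pr → (Pl ++ Pr) ≤T Q₁ → P₂ ≤T Q₂ → buildP Pl Pr P₂ ≤T buildQ Q₁ Q₂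
buildP≤buildQ Pl Pr Q₁ P₂ Q₂ dPr le₁ le₂ =
  subst (buildP Pl Pr P₂ ≤T_) (cong (u ∷_) (sym (++-assoc Pl Pr (d ∷ P₂)))) (≤T-prefix (u ∷ Pl) (d-past-dyck Pr P₂ dPr))
  ◅◅ ≤T-prefix [ u ] (≤T-suffix (d ∷ P₂) le₁)
  ◅◅ ≤T-after Q₁ le₂

-- Conversely, every Dyck path below u Q₁ d Q₂ is u P₁ˡ d P₁ʳ P₂ with P₁ˡP₁ʳ ≤ Q₁ and P₂ ≤ Q₂:
-- split it along u Q₁ d · Q₂, then project the first factor u P₁ˡ d P₁ʳ ≤ u Q₁ d.
interval-decomposition : ∀ {P} Q₁ Q₂ → P ≤T buildQ Q₁ Q₂ → Dyck Q₁ → Dyck Q₂ → Dyck P →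
  ∃[ Pl ] ∃[ Pr ] ∃[ P₂ ] (P ≡ buildP Pl Pr P₂ × Dyck Pl × Dyck Pr × Dyck P₂ × (Pl ++ Pr) ≤T Q₁ × P₂ ≤T Q₂)
interval-decomposition Q₁ Q₂ le dQ₁ dQ₂ dP
  with P′ , P₂ , refl , le′ , le₂ , dP′ , dP₂ ← ≤T-splits le (excursion Q₁) Q₂
         (cong (u ∷_) (sym (++-assoc Q₁ [ d ] Q₂))) (dyck-excursion Q₁ dQ₁) dQ₂ dP
  with Pl , Pr , refl , dPl , dPr ← first-return P′ dP′ (positive-size-nonempty P′ (≤T-size le′) (s≤s z≤n)) =
  Pl , Pr , P₂ , cong (u ∷_) (++-assoc Pl (d ∷ Pr) P₂) , dPl , dPr , dP₂ ,
  subst ((Pl ++ Pr) ≤T_) (++-identityʳ Q₁) (≤T-project le′ Pl Pr Q₁ [] refl refl dPl dPr dQ₁) , le₂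

construction-sync : ∀ Pl Pr Q₁ P₂ Q₂ → PPSync Pl Pr Q₁ → SyncAny P₂ Q₂ → SyncPos (buildP Pl Pr P₂) (buildQ Q₁ Q₂)
construction-sync Pl Pr Q₁ P₂ Q₂ I₁ (_ , I₂) =
  size (buildQ Q₁ Q₂) , s≤s z≤n ,
  synchronized (buildP Pl Pr P₂) (buildQ Q₁ Q₂)
    (dyck-wrap Pl (Pr ++ P₂) dPl (dyck-++ Pr P₂ dPr (sync-dyckP I₂)))
    (dyck-wrap Q₁ Q₂ dQ₁ (sync-dyckQ I₂))
    (buildP≤buildQ Pl Pr Q₁ P₂ Q₂ dPr (Sync.le J₁) (Sync.le I₂))
    (afterUps-build Pl Pr Q₁ P₂ Q₂ dPl dPr dQ₁ (PPSync.proper I₁) (sync-size J₁) (sync-afterUps J₁) (sync-afterUps I₂))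
  where
  J₁ : Sync (proj₁ (PPSync.sync I₁)) (Pl ++ Pr) Q₁
  J₁ = pointed-interval I₁
  dPl : Dyck Pl
  dPl = pointed-dyckˡ I₁
  dPr : Dyck Pr
  dPr = pointed-dyckʳ I₁
  dQ₁ : Dyck Q₁
  dQ₁ = pointed-dyckQ I₁

-- Injectivity: the first-return decompositions of the two paths recover Q₁, Q₂, P₁ˡ and
-- P₁ʳP₂, and P₁ʳ is the Dyck prefix of the right size.
construction-injective : ∀ Pl Pr Q₁ P₂ Q₂ Pl′ Pr′ Q₁′ P₂′ Q₂′ →
  PPSync Pl Pr Q₁ → SyncAny P₂ Q₂ → PPSync Pl′ Pr′ Q₁′ → SyncAny P₂′ Q₂′ →
  buildP Pl Pr P₂ ≡ buildP Pl′ Pr′ P₂′ → buildQ Q₁ Q₂ ≡ buildQ Q₁′ Q₂′ →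
  Pl ≡ Pl′ × Pr ≡ Pr′ × Q₁ ≡ Q₁′ × P₂ ≡ P₂′ × Q₂ ≡ Q₂′
construction-injective Pl Pr Q₁ P₂ Q₂ Pl′ Pr′ Q₁′ P₂′ Q₂′ I₁ _ I₁′ _ eP eQ
  with refl , refl ← first-return-unique Q₁ Q₁′ (pointed-dyckQ I₁) (pointed-dyckQ I₁′) eQ
  with refl , eRest ← first-return-unique Pl Pl′ (pointed-dyckˡ I₁) (pointed-dyckˡ I₁′) eP
  with refl , refl ← dyck-prefix-unique Pr Pr′ (pointed-dyckʳ I₁) (pointed-dyckʳ I₁′) (pointed-size I₁ I₁′) eRest =
  refl , refl , refl , refl , refl

-- Surjectivity: decompose Q = u Q₁ d Q₂ and P accordingly; the letter words of the parts
-- agree, and the first letters force P₁ˡP₁ʳ to be properly pointed.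
construction-surjective : ∀ P Q → SyncPos P Q →
  ∃[ Pl ] ∃[ Pr ] ∃[ Q₁ ] ∃[ P₂ ] ∃[ Q₂ ] (PPSync Pl Pr Q₁ × SyncAny P₂ Q₂ × P ≡ buildP Pl Pr P₂ × Q ≡ buildQ Q₁ Q₂)
construction-surjective P Q (_ , 0<n , I)
  with Q₁ , Q₂ , refl , dQ₁ , dQ₂ ← first-return Q (sync-dyckQ I) (positive-size-nonempty Q (Sync.sizeQ I) 0<n)
  with Pl , Pr , P₂ , refl , dPl , dPr , dP₂ , le₁ , le₂ ← interval-decomposition Q₁ Q₂ (Sync.le I) dQ₁ dQ₂ (sync-dyckP I)
  with first , a₁ , a₂ ← afterUps-build⁻¹ Pl Pr Q₁ P₂ Q₂ dPl dPr (≤T-size le₁) (sync-afterUps I) =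
  Pl , Pr , Q₁ , P₂ , Q₂ , I₁ , (_ , synchronized P₂ Q₂ dP₂ dQ₂ le₂ a₂) , refl , refl
  where
  I₁ : PPSync Pl Pr Q₁
  I₁ = record
    { dyckl = toIsDyck Pl dPl ; dyckr = toIsDyck Pr dPr
    ; proper = proper-from-nextLetter Pl Pr Q₁ (Pr ++ P₂) Q₂ dPr dQ₁ (≤T-size le₁) first
    ; sync = _ , synchronized (Pl ++ Pr) Q₁ (dyck-++ Pl Pr dPl dPr) dQ₁ le₁ a₁ }

proposition1 : (∀ Pl Pr Q1 P2 Q2 → PPSync Pl Pr Q1 → SyncAny P2 Q2 →
    SyncPos (buildP Pl Pr P2) (buildQ Q1 Q2))
    × (∀ Pl Pr Q1 P2 Q2 Pl′ Pr′ Q1′ P2′ Q2′ →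
    PPSync Pl Pr Q1 → SyncAny P2 Q2 → PPSync Pl′ Pr′ Q1′ → SyncAny P2′ Q2′ →
    buildP Pl Pr P2 ≡ buildP Pl′ Pr′ P2′ → buildQ Q1 Q2 ≡ buildQ Q1′ Q2′ →
    Pl ≡ Pl′ × Pr ≡ Pr′ × Q1 ≡ Q1′ × P2 ≡ P2′ × Q2 ≡ Q2′)
    × (∀ P Q → SyncPos P Q →
    ∃[ Pl ] ∃[ Pr ] ∃[ Q1 ] ∃[ P2 ] ∃[ Q2 ]
    (PPSync Pl Pr Q1 × SyncAny P2 Q2 × P ≡ buildP Pl Pr P2 × Q ≡ buildQ Q1 Q2))
proposition1 = construction-sync , construction-injective , construction-surjective
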